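{- For every $f \in \mathcal{G}$, the cycle decidability problem $\{\langle x,x'\rangle : x \equiv_f x'\}$ is one-one reducible to the Halting Problem $K$, and there exists $f' \in \mathcal{G}$ such that $K$ is one-one reducible to the cycle decidability problem $\{\langle x,x'\rangle : x \equiv_{f'} x'\}$ of $f'$.
   Context: $\mathcal{G}$ is the group of recursive permutations of $\mathbb{N}$; $x\equiv_f x'$ means $x'=f^k(x)$ for some $k\in\mathbb{Z}$; $\langle\cdot,\cdot\rangle$ is a recursive pairing bijection $\mathbb{N}^2\to\mathbb{N}$. $K = \{x : \varphi_x(x) \text{ halts}\}$. $A$ is one-one reducible to $B$ if there is a total recursive injective $r$ with $x\in A \iff r(x)\in B$. -}

module Defs where

open import Data.Nat using (ℕ; zero; suc; _+_)
open import Data.Product using (_×_; _,_; ∃; proj₁; proj₂)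
open import Data.Sum using (_⊎_)
open import Data.Maybe using (Maybe; just; nothing; _>>=_)
open import Relation.Binary.PropositionalEquality using (_≡_)
open import Function.Bundles using (_⇔_)
open import Function.Definitions using (Injective; Bijective)

tri : ℕ → ℕ
tri zero    = zero
tri (suc n) = suc n + tri n

⟨_,_⟩ : ℕ → ℕ → ℕ
⟨ a , b ⟩ = tri (a + b) + a

-- inverse, by walking the Cantor enumeration (0,0),(0,1),(1,0),(0,2),…
unpair : ℕ → ℕ × ℕ
unpair zero    = 0 , 0
unpair (suc z) with unpair z
... | a , zero  = 0 , suc a
... | a , suc b = suc a , b

π₁ π₂ : ℕ → ℕ
π₁ z = proj₁ (unpair z)
π₂ z = proj₂ (unpair z)

-- A Gödel-numbered model of partial recursive functions ℕ ⇀ ℕ.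
-- A code e is read as ⟨tag , args⟩ :
--   tag 0 : x ↦ 0                 tag 1 : x ↦ x+1
--   tag 2 : x ↦ π₁ x              tag 3 : x ↦ π₂ x
--   tag 4 : args = ⟨f,g⟩, x ↦ φ_f (φ_g x)            (composition)
--   tag 5 : args = ⟨f,g⟩, x ↦ ⟨φ_f x , φ_g x⟩         (pairing)
--   tag 6 : args = ⟨f,g⟩, ⟨x,n⟩ ↦ h n  where h 0 = φ_f x,
--           h (n+1) = φ_g ⟨x,⟨n,h n⟩⟩                 (primitive recursion)
--   tag ≥ 7 : args = f, x ↦ least n with φ_f ⟨x,n⟩ = 0,
--           φ_f ⟨x,m⟩ defined for m < n               (μ-operator)
-- eval k e x is the evaluation with fuel k.

primRec : (ℕ → Maybe ℕ) → (ℕ → Maybe ℕ) → ℕ → ℕ → Maybe ℕ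
primRec base step x zero    = base x
primRec base step x (suc n) = primRec base step x n >>= λ r → step ⟨ x , ⟨ n , r ⟩ ⟩

muSearch : ℕ → (ℕ → Maybe ℕ) → ℕ → ℕ → Maybe ℕ
muSearch zero    g x i = nothing
muSearch (suc b) g x i = g ⟨ x , i ⟩ >>= λ where
  zero    → just i
  (suc _) → muSearch b g x (suc i)

eval : ℕ → ℕ → ℕ → Maybe ℕ
eval zero    e x = nothing
eval (suc k) e x with unpair e
... | 0 , _ = just 0
... | 1 , _ = just (suc x)
... | 2 , _ = just (π₁ x)
... | 3 , _ = just (π₂ x)
... | 4 , a = eval k (π₂ a) x >>= eval k (π₁ a)
... | 5 , a = eval k (π₁ a) x >>= λ u → eval k (π₂ a) x >>= λ v → just ⟨ u , v ⟩
... | 6 , a = primRec (eval k (π₁ a)) (eval k (π₂ a)) (π₁ x) (π₂ x)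
... | suc (suc (suc (suc (suc (suc (suc _)))))) , a = muSearch k (eval k a) x 0

Halts : ℕ → ℕ → Set
Halts e x = ∃ λ k → ∃ λ y → eval k e x ≡ just y

Computes : ℕ → (ℕ → ℕ) → Set
Computes e f = ∀ x → ∃ λ k → eval k e x ≡ just (f x)

Recursive : (ℕ → ℕ) → Set
Recursive f = ∃ λ e → Computes e f

K : ℕ → Set
K x = Halts x x

_≤₁_ : (ℕ → Set) → (ℕ → Set) → Set
A ≤₁ B = ∃ λ (r : ℕ → ℕ) → Recursive r × Injective _≡_ _≡_ r × (∀ x → A x ⇔ B (r x))

-- f ∈ 𝒢 : recursive permutation of ℕ
RecPerm : (ℕ → ℕ) → Set
RecPerm f = Recursive f × Bijective _≡_ _≡_ f

iter : (ℕ → ℕ) → ℕ → ℕ → ℕ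
iter f zero    x = x
iter f (suc n) x = f (iter f n x)

-- x ≡_f x' : x' = f^k(x) for some k ∈ ℤ
-- (k = n ≥ 0 : f^n x ≡ x' ;  k = -n : f^n x' ≡ x)
_≡[_]_ : ℕ → (ℕ → ℕ) → ℕ → Set
x ≡[ f ] x' = ∃ λ n → (iter f n x ≡ x') ⊎ (iter f n x' ≡ x)

Cyc : (ℕ → ℕ) → ℕ → Set
Cyc f z = ∃ λ x → ∃ λ x' → z ≡ ⟨ x , x' ⟩ × x ≡[ f ] x'

-- Cyc f is Σ₁: ⟨x , x′⟩ ∈ Cyc f iff fⁿ x = x′ or fⁿ x′ = x for some n, a test that is
-- primitive recursive relative to f, and every Σ₁ set reduces one-one to K.
-- Conversely, a recursive permutation σ moves the points ⟨ x , ⟨ c , i ⟩ ⟩, c = 0, 1, 2, 3, along a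
-- ladder: the orbit … → (1,1) → (1,0) → (0,0) → (0,1) → … climbs lane 0 while φ_x(x) has not
-- halted within i steps; at the first halting stage s it crosses to (3,s), descends lane 3 to
-- (3,0) and continues up lane 2 from (2,0). Hence (0,0) and (2,0) lie in one orbit iff x ∈ K.
-- That σ is recursive needs step-bounded evaluation to be a total recursive function, which
-- follows by simulating eval on a small-step machine whose transition is primitive recursive.
module Submission where

open import Defs
open import Data.Nat using (ℕ; zero; suc; pred; _+_; _∸_; _≤_; _<_; _⊔_; s≤s; z<s; _≟_)
open import Data.Nat.Properties
open import Data.Product using (_×_; _,_; ∃; proj₁; proj₂; uncurry)
open import Data.Sum using (_⊎_; inj₁; inj₂)
open import Data.Maybe using (Maybe; just; nothing; _>>=_)
open import Data.Maybe.Properties using (just-injective)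
open import Data.List using (List; []; _∷_)
open import Data.Empty using (⊥-elim)
open import Relation.Nullary using (¬_; yes; no; ¬?)
open import Relation.Nullary.Decidable using (decidable-stable)
open import Relation.Unary using (Decidable)
open import Relation.Binary.PropositionalEquality
open import Function.Bundles using (_⇔_; mk⇔; Equivalence; Bijection; mk↔ₛ′)
open import Function.Properties.Inverse using (↔⇒⤖)
open import Function.Construct.Composition using (_⇔-∘_)
open import Function.Definitions using (Injective; Bijective)
open ≡-Reasoning

pair-zero-suc : ∀ b → ⟨ 0 , suc b ⟩ ≡ suc ⟨ b , 0 ⟩
pair-zero-suc b rewrite +-identityʳ b | +-identityʳ (b + tri b) = cong suc (+-comm b (tri b))

pair-suc : ∀ a b → ⟨ suc a , b ⟩ ≡ suc ⟨ a , suc b ⟩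
pair-suc a b rewrite +-suc a b = +-suc (suc (a + b) + tri (a + b)) a

unpair-suc-zero : ∀ z {a} → unpair z ≡ (a , 0) → unpair (suc z) ≡ (0 , suc a)
unpair-suc-zero z eq with unpair z
unpair-suc-zero z refl | _ = refl

unpair-suc-suc : ∀ z {a b} → unpair z ≡ (a , suc b) → unpair (suc z) ≡ (suc a , b)
unpair-suc-suc z eq with unpair z
unpair-suc-suc z refl | _ = refl

unpair-pair : ∀ a b → unpair ⟨ a , b ⟩ ≡ (a , b)
unpair-pair a b = on-diagonal (a + b) a b refl
  where
  on-diagonal : ∀ n a b → a + b ≡ n → unpair ⟨ a , b ⟩ ≡ (a , b)
  on-diagonal n       zero    zero    _  = refl
  on-diagonal (suc n) zero    (suc b) eq = begin
    unpair ⟨ 0 , suc b ⟩  ≡⟨ cong unpair (pair-zero-suc b) ⟩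
    unpair (suc ⟨ b , 0 ⟩) ≡⟨ unpair-suc-zero ⟨ b , 0 ⟩ (on-diagonal n b 0 b+0≡n) ⟩
    (0 , suc b)            ∎
    where
    b+0≡n : b + 0 ≡ n
    b+0≡n = trans (+-identityʳ b) (suc-injective eq)
  on-diagonal n       (suc a) b       eq = begin
    unpair ⟨ suc a , b ⟩       ≡⟨ cong unpair (pair-suc a b) ⟩
    unpair (suc ⟨ a , suc b ⟩) ≡⟨ unpair-suc-suc ⟨ a , suc b ⟩ (on-diagonal n a (suc b) (trans (+-suc a b) eq)) ⟩
    (suc a , b)                ∎

π₁-pair : ∀ a b → π₁ ⟨ a , b ⟩ ≡ a
π₁-pair a b = cong proj₁ (unpair-pair a b)

π₂-pair : ∀ a b → π₂ ⟨ a , b ⟩ ≡ b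
π₂-pair a b = cong proj₂ (unpair-pair a b)

pair-π : ∀ z → ⟨ π₁ z , π₂ z ⟩ ≡ z
pair-π zero = refl
pair-π (suc z) with unpair z | pair-π z
... | a , zero  | eq = trans (pair-zero-suc a) (cong suc eq)
... | a , suc b | eq = trans (pair-suc a b) (cong suc eq)

pair-π-π₂ : ∀ z → ⟨ π₁ z , ⟨ π₁ (π₂ z) , π₂ (π₂ z) ⟩ ⟩ ≡ z
pair-π-π₂ z = trans (cong ⟨ π₁ z ,_⟩ (pair-π (π₂ z))) (pair-π z)

pair-injectiveˡ : ∀ {a b c d} → ⟨ a , b ⟩ ≡ ⟨ c , d ⟩ → a ≡ c
pair-injectiveˡ {a} {b} {c} {d} eq = trans (sym (π₁-pair a b)) (trans (cong π₁ eq) (π₁-pair c d))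

pair-injectiveʳ : ∀ {a b c d} → ⟨ a , b ⟩ ≡ ⟨ c , d ⟩ → b ≡ d
pair-injectiveʳ {a} {b} {c} {d} eq = trans (sym (π₂-pair a b)) (trans (cong π₂ eq) (π₂-pair c d))

infix 4 _⊑_

_⊑_ : Maybe ℕ → Maybe ℕ → Set
m ⊑ m′ = ∀ {u} → m ≡ just u → m′ ≡ just u

>>=-mono : ∀ {m m′ : Maybe ℕ} {f g : ℕ → Maybe ℕ} → m ⊑ m′ → (∀ u → f u ⊑ g u) →
           (m >>= f) ⊑ (m′ >>= g)
>>=-mono {just u} m⊑m′ f⊑g eq rewrite m⊑m′ refl = f⊑g u eq

primRec-mono : ∀ {b b′ s s′ : ℕ → Maybe ℕ} → (∀ x → b x ⊑ b′ x) → (∀ x → s x ⊑ s′ x) →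
               ∀ x n → primRec b s x n ⊑ primRec b′ s′ x n
primRec-mono b⊑b′ s⊑s′ x zero    = b⊑b′ x
primRec-mono b⊑b′ s⊑s′ x (suc n) = >>=-mono (primRec-mono b⊑b′ s⊑s′ x n) (λ _ → s⊑s′ _)

muSearch-mono : ∀ {g g′ : ℕ → Maybe ℕ} → (∀ x → g x ⊑ g′ x) →
                ∀ b x i → muSearch b g x i ⊑ muSearch (suc b) g′ x i
muSearch-mono {g} g⊑g′ (suc b) x i eq with g ⟨ x , i ⟩ in gi
... | just zero    rewrite g⊑g′ _ gi = eq
... | just (suc _) rewrite g⊑g′ _ gi = muSearch-mono g⊑g′ b x (suc i) eq

eval-mono : ∀ k e x → eval k e x ⊑ eval (suc k) e x
eval-mono (suc k) e x with unpair e
... | 0 , _ = λ eq → eq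
... | 1 , _ = λ eq → eq
... | 2 , _ = λ eq → eq
... | 3 , _ = λ eq → eq
... | 4 , a = >>=-mono (eval-mono k (π₂ a) x) (eval-mono k (π₁ a))
... | 5 , a = >>=-mono (eval-mono k (π₁ a) x) (λ _ → >>=-mono (eval-mono k (π₂ a) x) (λ _ eq → eq))
... | 6 , a = primRec-mono (eval-mono k (π₁ a)) (eval-mono k (π₂ a)) (π₁ x) (π₂ x)
... | suc (suc (suc (suc (suc (suc (suc _)))))) , a = muSearch-mono (eval-mono k a) k x 0

eval-mono-≤ : ∀ {k k′} e x → k ≤ k′ → eval k e x ⊑ eval k′ e x
eval-mono-≤ {k} e x k≤k′ with m≤n⇒∃[o]m+o≡n k≤k′
... | o , refl = add-fuel o
  where
  add-fuel : ∀ o → eval k e x ⊑ eval (k + o) e x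
  add-fuel zero    rewrite +-identityʳ k = λ eq → eq
  add-fuel (suc o) rewrite +-suc k o     = λ eq → eval-mono (k + o) e x (add-fuel o eq)

infix 4 _·_⇓_

_·_⇓_ : ℕ → ℕ → ℕ → Set
e · x ⇓ y = ∃ λ k → eval k e x ≡ just y

⇓-deterministic : ∀ {e x y y′} → e · x ⇓ y → e · x ⇓ y′ → y ≡ y′
⇓-deterministic {e} {x} (k , p) (k′ , q) =
  just-injective (trans (sym (eval-mono-≤ e x (m≤m⊔n k k′) p)) (eval-mono-≤ e x (m≤n⊔m k k′) q))

succ-code π₁-code π₂-code : ℕ
succ-code = ⟨ 1 , 0 ⟩
π₁-code   = ⟨ 2 , 0 ⟩
π₂-code   = ⟨ 3 , 0 ⟩

∘-code pair-code rec-code : ℕ → ℕ → ℕ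
∘-code    f g = ⟨ 4 , ⟨ f , g ⟩ ⟩
pair-code f g = ⟨ 5 , ⟨ f , g ⟩ ⟩
rec-code  f g = ⟨ 6 , ⟨ f , g ⟩ ⟩

μ-code : ℕ → ℕ
μ-code a = ⟨ 7 , a ⟩

eval-∘ : ∀ k f g x → eval (suc k) (∘-code f g) x ≡ (eval k g x >>= eval k f)
eval-∘ k f g x rewrite unpair-pair 4 ⟨ f , g ⟩ | π₁-pair f g | π₂-pair f g = refl

eval-pair : ∀ k f g x →
            eval (suc k) (pair-code f g) x ≡ (eval k f x >>= λ u → eval k g x >>= λ v → just ⟨ u , v ⟩)
eval-pair k f g x rewrite unpair-pair 5 ⟨ f , g ⟩ | π₁-pair f g | π₂-pair f g = refl

eval-rec : ∀ k f g x → eval (suc k) (rec-code f g) x ≡ primRec (eval k f) (eval k g) (π₁ x) (π₂ x)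
eval-rec k f g x rewrite unpair-pair 6 ⟨ f , g ⟩ | π₁-pair f g | π₂-pair f g = refl

eval-μ : ∀ k a x → eval (suc k) (μ-code a) x ≡ muSearch k (eval k a) x 0
eval-μ k a x rewrite unpair-pair 7 a = refl

⇓-∘ : ∀ {f g x y z} → g · x ⇓ y → f · y ⇓ z → ∘-code f g · x ⇓ z
⇓-∘ {f} {g} {x} {y} {z} (k₁ , g⇓) (k₂ , f⇓) = suc k , (begin
  eval (suc k) (∘-code f g) x ≡⟨ eval-∘ k f g x ⟩
  (eval k g x >>= eval k f)   ≡⟨ cong (_>>= eval k f) (eval-mono-≤ g x (m≤m⊔n k₁ k₂) g⇓) ⟩
  eval k f y                  ≡⟨ eval-mono-≤ f y (m≤n⊔m k₁ k₂) f⇓ ⟩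
  just z                      ∎)
  where
  k : ℕ
  k = k₁ ⊔ k₂

⇓-pair : ∀ {f g x y z} → f · x ⇓ y → g · x ⇓ z → pair-code f g · x ⇓ ⟨ y , z ⟩
⇓-pair {f} {g} {x} {y} {z} (k₁ , f⇓) (k₂ , g⇓) = suc k , (begin
  eval (suc k) (pair-code f g) x
    ≡⟨ eval-pair k f g x ⟩
  (eval k f x >>= λ u → eval k g x >>= λ v → just ⟨ u , v ⟩)
    ≡⟨ cong (_>>= λ u → eval k g x >>= λ v → just ⟨ u , v ⟩) (eval-mono-≤ f x (m≤m⊔n k₁ k₂) f⇓) ⟩
  (eval k g x >>= λ v → just ⟨ y , v ⟩)
    ≡⟨ cong (_>>= λ v → just ⟨ y , v ⟩) (eval-mono-≤ g x (m≤n⊔m k₁ k₂) g⇓) ⟩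
  just ⟨ y , z ⟩
    ∎)
  where
  k : ℕ
  k = k₁ ⊔ k₂

natRec : (ℕ → ℕ) → (ℕ → ℕ) → ℕ → ℕ → ℕ
natRec b s y zero    = b y
natRec b s y (suc n) = s ⟨ y , ⟨ n , natRec b s y n ⟩ ⟩

⇓-rec : ∀ {f g b s} → (∀ x → f · x ⇓ b x) → (∀ x → g · x ⇓ s x) →
        ∀ x → rec-code f g · x ⇓ natRec b s (π₁ x) (π₂ x)
⇓-rec {f} {g} {b} {s} f⇓ g⇓ x =
  let k , rec⇓ = unfold (π₁ x) (π₂ x)
  in suc k , trans (eval-rec k f g x) rec⇓
  where
  unfold : ∀ y n → ∃ λ k → primRec (eval k f) (eval k g) y n ≡ just (natRec b s y n)
  unfold y zero    = f⇓ y
  unfold y (suc n) with unfold y n | g⇓ ⟨ y , ⟨ n , natRec b s y n ⟩ ⟩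
  ... | k₁ , rec⇓ | k₂ , step⇓ = k , (begin
    primRec (eval k f) (eval k g) y (suc n)  ≡⟨ cong (_>>= λ r → eval k g ⟨ y , ⟨ n , r ⟩ ⟩) (more-fuel rec⇓) ⟩
    eval k g ⟨ y , ⟨ n , natRec b s y n ⟩ ⟩ ≡⟨ eval-mono-≤ g _ (m≤n⊔m k₁ k₂) step⇓ ⟩
    just (natRec b s y (suc n))              ∎)
    where
    k : ℕ
    k = k₁ ⊔ k₂
    more-fuel : primRec (eval k₁ f) (eval k₁ g) y n ⊑ primRec (eval k f) (eval k g) y n
    more-fuel = primRec-mono (λ x → eval-mono-≤ f x (m≤m⊔n k₁ k₂)) (λ x → eval-mono-≤ g x (m≤m⊔n k₁ k₂)) y n

⇓-succ : ∀ x → succ-code · x ⇓ suc x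
⇓-succ x = 1 , refl

⇓-π₁ : ∀ x → π₁-code · x ⇓ π₁ x
⇓-π₁ x = 1 , refl

⇓-π₂ : ∀ x → π₂-code · x ⇓ π₂ x
⇓-π₂ x = 1 , refl

const-code : ℕ → ℕ
const-code zero    = 0
const-code (suc n) = ∘-code succ-code (const-code n)

⇓-const : ∀ n x → const-code n · x ⇓ n
⇓-const zero    x = 1 , refl
⇓-const (suc n) x = ⇓-∘ (⇓-const n x) (⇓-succ n)

const-code-injective : ∀ {a b} → const-code a ≡ const-code b → a ≡ b
const-code-injective {zero}  {zero}  _  = refl
const-code-injective {zero}  {suc b} eq = ⊥-elim (0≢1+n (trans eq (pair-suc 3 ⟨ succ-code , const-code b ⟩)))
const-code-injective {suc a} {zero}  eq = ⊥-elim (0≢1+n (trans (sym eq) (pair-suc 3 ⟨ succ-code , const-code a ⟩)))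
const-code-injective {suc a} {suc b} eq =
  cong suc (const-code-injective (pair-injectiveʳ {succ-code} {_} {succ-code} (pair-injectiveʳ {4} {_} {4} eq)))

id-code : ℕ
id-code = pair-code π₁-code π₂-code

⇓-id : ∀ x → id-code · x ⇓ x
⇓-id x = subst (id-code · x ⇓_) (pair-π x) (⇓-pair (⇓-π₁ x) (⇓-π₂ x))

⇓-∘⁻¹ : ∀ {f g x z} → ∘-code f g · x ⇓ z → ∃ λ y → g · x ⇓ y × f · y ⇓ z
⇓-∘⁻¹ (zero , ())
⇓-∘⁻¹ {f} {g} {x} {z} (suc k , ∘⇓) = split (eval k g x) refl (trans (sym (eval-∘ k f g x)) ∘⇓)
  where
  split : ∀ m → eval k g x ≡ m → (m >>= eval k f) ≡ just z → ∃ λ y → g · x ⇓ y × f · y ⇓ z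
  split (just y) g⇓ f⇓ = y , (k , g⇓) , (k , f⇓)

least-witness : ∀ {P : ℕ → Set} → Decidable P → ∀ {n} → P n → ∃ λ m → P m × (∀ j → j < m → ¬ P j)
least-witness {P} P? {n} Pn = search n 0 (+-identityʳ n) (λ _ ())
  where
  search : ∀ d i → d + i ≡ n → (∀ j → j < i → ¬ P j) → ∃ λ m → P m × (∀ j → j < m → ¬ P j)
  search d i eq below with P? i
  ... | yes Pi = i , Pi , below
  search zero    i refl below | no ¬Pi = ⊥-elim (¬Pi Pn)
  search (suc d) i eq   below | no ¬Pi = search d (suc i) (trans (+-suc d i) eq) below′
    where
    below′ : ∀ j → j < suc i → ¬ P j
    below′ j j<1+i with j ≟ i
    ... | yes refl = ¬Pi
    ... | no j≢i   = below j (≤∧≢⇒< (≤-pred j<1+i) j≢i)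

muSearch-hit : ∀ (g : ℕ → Maybe ℕ) {x i b} → g ⟨ x , i ⟩ ≡ just 0 → muSearch (suc b) g x i ≡ just i
muSearch-hit g g≡0 rewrite g≡0 = refl

muSearch-miss : ∀ (g : ℕ → Maybe ℕ) {x i b u} → g ⟨ x , i ⟩ ≡ just (suc u) →
                muSearch (suc b) g x i ≡ muSearch b g x (suc i)
muSearch-miss g g≡1+u rewrite g≡1+u = refl

muSearch-sound : ∀ {g : ℕ → Maybe ℕ} b x i {y} → muSearch b g x i ≡ just y → g ⟨ x , y ⟩ ≡ just 0
muSearch-sound {g} (suc b) x i eq with g ⟨ x , i ⟩ in gi
muSearch-sound {g} (suc b) x i refl | just zero    = gi
muSearch-sound {g} (suc b) x i eq   | just (suc _) = muSearch-sound b x (suc i) eq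

⇓-μ : ∀ {a x n} (G : ℕ → ℕ) → (∀ m → a · ⟨ x , m ⟩ ⇓ G m) → G n ≡ 0 → (∀ m → m < n → ¬ G m ≡ 0) →
      μ-code a · x ⇓ n
⇓-μ {a} {x} {n} G a⇓ Gn≡0 below =
  let k , finds = search-from n 0 (+-identityʳ n)
  in suc (suc n ⊔ k) , trans (eval-μ _ a x) (finds (m≤m⊔n (suc n) k) (m≤n⊔m (suc n) k))
  where
  search-from : ∀ d i → d + i ≡ n →
                ∃ λ k → ∀ {b k′} → d < b → k ≤ k′ → muSearch b (eval k′ a) x i ≡ just n
  search-from zero i refl =
    let k , a⇓n = a⇓ n
    in k , λ { {suc b} {k′} _ k≤k′ →
                 muSearch-hit (eval k′ a) (eval-mono-≤ a _ k≤k′ (trans a⇓n (cong just Gn≡0))) }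
  search-from (suc d) i eq with G i in Gi | a⇓ i | search-from d (suc i) (trans (+-suc d i) eq)
  ... | zero  | _        | _         = ⊥-elim (below i (subst (i <_) eq (m<n+m i z<s)) Gi)
  ... | suc u | k₁ , a⇓i | k₂ , finds = k₁ ⊔ k₂ , λ { {suc b} {k′} (s≤s d<b) k≤k′ → trans
        (muSearch-miss (eval k′ a) (eval-mono-≤ a _ (≤-trans (m≤m⊔n k₁ k₂) k≤k′) a⇓i))
        (finds d<b (≤-trans (m≤n⊔m k₁ k₂) k≤k′)) }

⇓-μ⁻¹ : ∀ {a x y} → μ-code a · x ⇓ y → a · ⟨ x , y ⟩ ⇓ 0
⇓-μ⁻¹ (zero , ())
⇓-μ⁻¹ {a} {x} (suc k , μ⇓) = k , muSearch-sound k x 0 (trans (sym (eval-μ k a x)) μ⇓)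

-- Terms act on binary trees of numbers rather than on numbers, so that projecting an
-- explicitly built pair reduces definitionally; `flatten` connects the two semantics.
data Tree : Set where
  leaf : ℕ → Tree
  node : Tree → Tree → Tree

flatten : Tree → ℕ
flatten (leaf n)   = n
flatten (node a b) = ⟨ flatten a , flatten b ⟩

fst snd : Tree → Tree
fst (leaf n)   = leaf (π₁ n)
fst (node a b) = a
snd (leaf n)   = leaf (π₂ n)
snd (node a b) = b

flatten-fst : ∀ τ → flatten (fst τ) ≡ π₁ (flatten τ)
flatten-fst (leaf n)   = refl
flatten-fst (node a b) = sym (π₁-pair (flatten a) (flatten b))

flatten-snd : ∀ τ → flatten (snd τ) ≡ π₂ (flatten τ)
flatten-snd (leaf n)   = refl
flatten-snd (node a b) = sym (π₂-pair (flatten a) (flatten b))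

infixr 9 _∙_

data Term : Set where
  Z S P₁ P₂ Id : Term
  Const        : ℕ → Term
  _∙_          : Term → Term → Term
  Pair Rec     : Term → Term → Term
  Ext          : (e : ℕ) (f : ℕ → ℕ) → Computes e f → Term

code : Term → ℕ
code Z           = 0
code S           = succ-code
code P₁          = π₁-code
code P₂          = π₂-code
code Id          = id-code
code (Const n)   = const-code n
code (t ∙ u)     = ∘-code (code t) (code u)
code (Pair t u)  = pair-code (code t) (code u)
code (Rec t u)   = rec-code (code t) (code u)
code (Ext e _ _) = e

⟦_⟧ᵀ : Term → Tree → Tree
recᵀ : Term → Term → Tree → ℕ → Tree
⟦ Z ⟧ᵀ         τ = leaf 0
⟦ S ⟧ᵀ         τ = leaf (suc (flatten τ))
⟦ P₁ ⟧ᵀ        τ = fst τ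
⟦ P₂ ⟧ᵀ        τ = snd τ
⟦ Id ⟧ᵀ        τ = τ
⟦ Const n ⟧ᵀ   τ = leaf n
⟦ t ∙ u ⟧ᵀ     τ = ⟦ t ⟧ᵀ (⟦ u ⟧ᵀ τ)
⟦ Pair t u ⟧ᵀ  τ = node (⟦ t ⟧ᵀ τ) (⟦ u ⟧ᵀ τ)
⟦ Rec t u ⟧ᵀ   τ = recᵀ t u (fst τ) (flatten (snd τ))
⟦ Ext _ f _ ⟧ᵀ τ = leaf (f (flatten τ))
recᵀ t u y zero    = ⟦ t ⟧ᵀ y
recᵀ t u y (suc n) = ⟦ u ⟧ᵀ (node y (node (leaf n) (recᵀ t u y n)))

⟦_⟧ : Term → ℕ → ℕ
⟦ t ⟧ x = flatten (⟦ t ⟧ᵀ (leaf x))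

code-⇓ : ∀ t τ → code t · flatten τ ⇓ flatten (⟦ t ⟧ᵀ τ)
code-⇓ Z           τ = 1 , refl
code-⇓ S           τ = ⇓-succ (flatten τ)
code-⇓ P₁          τ = subst (π₁-code · flatten τ ⇓_) (sym (flatten-fst τ)) (⇓-π₁ (flatten τ))
code-⇓ P₂          τ = subst (π₂-code · flatten τ ⇓_) (sym (flatten-snd τ)) (⇓-π₂ (flatten τ))
code-⇓ Id          τ = ⇓-id _
code-⇓ (Const n)   τ = ⇓-const n _
code-⇓ (t ∙ u)     τ = ⇓-∘ (code-⇓ u τ) (code-⇓ t (⟦ u ⟧ᵀ τ))
code-⇓ (Pair t u)  τ = ⇓-pair (code-⇓ t τ) (code-⇓ u τ)
code-⇓ (Ext e f c) τ = c (flatten τ)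
code-⇓ (Rec t u)   τ = subst (code (Rec t u) · flatten τ ⇓_) natRec≡recᵀ
                             (⇓-rec (λ x → code-⇓ t (leaf x)) (λ x → code-⇓ u (leaf x)) (flatten τ))
  where
  natRec-recᵀ : ∀ y n → natRec ⟦ t ⟧ ⟦ u ⟧ (flatten y) n ≡ flatten (recᵀ t u y n)
  natRec-recᵀ y zero    = ⇓-deterministic (code-⇓ t (leaf (flatten y))) (code-⇓ t y)
  natRec-recᵀ y (suc n) rewrite natRec-recᵀ y n =
    ⇓-deterministic (code-⇓ u (leaf ⟨ flatten y , ⟨ n , flatten (recᵀ t u y n) ⟩ ⟩))
                    (code-⇓ u (node y (node (leaf n) (recᵀ t u y n))))
  natRec≡recᵀ : natRec ⟦ t ⟧ ⟦ u ⟧ (π₁ (flatten τ)) (π₂ (flatten τ)) ≡ flatten (⟦ Rec t u ⟧ᵀ τ)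
  natRec≡recᵀ rewrite sym (flatten-fst τ) | sym (flatten-snd τ) = natRec-recᵀ (fst τ) (flatten (snd τ))

flatten-⟦⟧ᵀ : ∀ t τ → flatten (⟦ t ⟧ᵀ τ) ≡ ⟦ t ⟧ (flatten τ)
flatten-⟦⟧ᵀ t τ = ⇓-deterministic (code-⇓ t τ) (code-⇓ t (leaf (flatten τ)))

code-computes : ∀ t → Computes (code t) ⟦ t ⟧
code-computes t x = code-⇓ t (leaf x)

ifz : {A : Set} → ℕ → A → A → A
ifz zero    a b = a
ifz (suc _) a b = b

ifz-cong : ∀ {A : Set} {m n} {a b : A} → m ≡ n → ifz m a b ≡ ifz n a b
ifz-cong = cong (λ c → ifz c _ _)

Ifz : Term → Term → Term → Term
Ifz c a b = Rec P₁ (P₂ ∙ P₁) ∙ Pair (Pair a b) c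

Ifz-ᵀ : ∀ c a b τ →
        flatten (⟦ Ifz c a b ⟧ᵀ τ) ≡ ifz (flatten (⟦ c ⟧ᵀ τ)) (flatten (⟦ a ⟧ᵀ τ)) (flatten (⟦ b ⟧ᵀ τ))
Ifz-ᵀ c a b τ with flatten (⟦ c ⟧ᵀ τ)
... | zero  = refl
... | suc _ = refl

Pred : Term
Pred = Rec Z (P₁ ∙ P₂) ∙ Pair Z Id

Pred-ᵀ : ∀ τ → flatten (⟦ Pred ⟧ᵀ τ) ≡ pred (flatten τ)
Pred-ᵀ τ with flatten τ
... | zero  = refl
... | suc _ = refl

Monus : Term
Monus = Rec Id (Pred ∙ P₂ ∙ P₂)

Monus-ᵀ : ∀ α β → flatten (⟦ Monus ⟧ᵀ (node α β)) ≡ flatten α ∸ flatten β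
Monus-ᵀ α β = count-down (flatten β)
  where
  count-down : ∀ n → flatten (recᵀ Id (Pred ∙ P₂ ∙ P₂) α n) ≡ flatten α ∸ n
  count-down zero    = refl
  count-down (suc n) = begin
    flatten (⟦ Pred ⟧ᵀ (recᵀ Id (Pred ∙ P₂ ∙ P₂) α n)) ≡⟨ Pred-ᵀ (recᵀ Id (Pred ∙ P₂ ∙ P₂) α n) ⟩
    pred (flatten (recᵀ Id (Pred ∙ P₂ ∙ P₂) α n))     ≡⟨ cong pred (count-down n) ⟩
    pred (flatten α ∸ n)                               ≡⟨ pred[m∸n]≡m∸[1+n] (flatten α) n ⟩
    flatten α ∸ suc n                                  ∎

distinct : ℕ → ℕ → ℕ
distinct a b = ifz (a ∸ b) (ifz (b ∸ a) 0 1) 1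

distinct-refl : ∀ a → distinct a a ≡ 0
distinct-refl a rewrite n∸n≡0 a = refl

distinct≡0⇒≡ : ∀ a b → distinct a b ≡ 0 → a ≡ b
distinct≡0⇒≡ a b eq with a ∸ b in a∸b | b ∸ a in b∸a
distinct≡0⇒≡ a b eq   | zero  | zero = ≤-antisym (m∸n≡0⇒m≤n a∸b) (m∸n≡0⇒m≤n b∸a)
distinct≡0⇒≡ a b ()   | zero  | suc _
distinct≡0⇒≡ a b ()   | suc _ | _

Distinct : Term → Term → Term
Distinct a b = Ifz (Monus ∙ Pair a b) (Ifz (Monus ∙ Pair b a) Z (Const 1)) (Const 1)

Distinct-ᵀ : ∀ a b τ →
             flatten (⟦ Distinct a b ⟧ᵀ τ) ≡ distinct (flatten (⟦ a ⟧ᵀ τ)) (flatten (⟦ b ⟧ᵀ τ))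
Distinct-ᵀ a b τ
  rewrite Ifz-ᵀ (Monus ∙ Pair a b) (Ifz (Monus ∙ Pair b a) Z (Const 1)) (Const 1) τ
        | Ifz-ᵀ (Monus ∙ Pair b a) Z (Const 1) τ
        | Monus-ᵀ (⟦ a ⟧ᵀ τ) (⟦ b ⟧ᵀ τ) | Monus-ᵀ (⟦ b ⟧ᵀ τ) (⟦ a ⟧ᵀ τ) = refl

Iterate : Term → Term
Iterate F = Rec Id (F ∙ P₂ ∙ P₂)

Iterate-ᵀ : ∀ F α β → flatten (⟦ Iterate F ⟧ᵀ (node α β)) ≡ iter ⟦ F ⟧ (flatten β) (flatten α)
Iterate-ᵀ F α β = iterate (flatten β)
  where
  iterate : ∀ n → flatten (recᵀ Id (F ∙ P₂ ∙ P₂) α n) ≡ iter ⟦ F ⟧ n (flatten α)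
  iterate zero    = refl
  iterate (suc n) = trans (flatten-⟦⟧ᵀ F (recᵀ Id (F ∙ P₂ ∙ P₂) α n)) (cong ⟦ F ⟧ (iterate n))

-- One-one reductions to K

ConstCode : Term
ConstCode = Rec Z (Pair (Const 4) (Pair (Const succ-code) (P₂ ∙ P₂))) ∙ Pair Z Id

⟦ConstCode⟧ : ∀ n → ⟦ ConstCode ⟧ n ≡ const-code n
⟦ConstCode⟧ zero    = refl
⟦ConstCode⟧ (suc n) = cong (∘-code succ-code) (⟦ConstCode⟧ n)

Σ₁-≤₁-K : ∀ {A : ℕ → Set} {t} (G : ℕ → ℕ) → Computes t G →
          (∀ z → A z ⇔ ∃ λ n → G ⟨ z , n ⟩ ≡ 0) → A ≤₁ K
Σ₁-≤₁-K {A} {t} G t-computes A⇔ = r , r-recursive , r-injective , λ z → mk⇔ (to z) (from z)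
  where
  -- φ_(r z) ignores its input and searches for a witness of z ∈ A.
  r : ℕ → ℕ
  r z = ∘-code (μ-code t) (const-code z)

  R : Term
  R = Pair (Const 4) (Pair (Const (μ-code t)) ConstCode)

  r-recursive : Recursive r
  r-recursive = code R , λ z → subst (code R · z ⇓_) (cong (∘-code (μ-code t)) (⟦ConstCode⟧ z)) (code-computes R z)

  r-injective : Injective _≡_ _≡_ r
  r-injective {a} {b} eq =
    const-code-injective (pair-injectiveʳ {μ-code t} {const-code a} {μ-code t} {const-code b}
      (pair-injectiveʳ {4} {⟨ μ-code t , const-code a ⟩} {4} {⟨ μ-code t , const-code b ⟩} eq))

  to : ∀ z → A z → K (r z)
  to z Az = search (least-witness (λ n → G ⟨ z , n ⟩ ≟ 0) (proj₂ (Equivalence.to (A⇔ z) Az)))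
    where
    search : (∃ λ m → G ⟨ z , m ⟩ ≡ 0 × (∀ j → j < m → ¬ G ⟨ z , j ⟩ ≡ 0)) → K (r z)
    search (m , Gm≡0 , below) =
      let k , r⇓ = ⇓-∘ {μ-code t} {const-code z} (⇓-const z (r z))
                       (⇓-μ (λ n → G ⟨ z , n ⟩) (λ n → t-computes ⟨ z , n ⟩) Gm≡0 below)
      in k , m , r⇓

  from : ∀ z → K (r z) → A z
  from z (k , y , r⇓) =
    let u , const⇓ , μ⇓ = ⇓-∘⁻¹ {μ-code t} {const-code z} (k , r⇓)
        t⇓0 = subst (λ w → t · ⟨ w , y ⟩ ⇓ 0) (⇓-deterministic const⇓ (⇓-const z (r z))) (⇓-μ⁻¹ μ⇓)
    in Equivalence.from (A⇔ z) (y , ⇓-deterministic (t-computes ⟨ z , y ⟩) t⇓0)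

orbit-test : (ℕ → ℕ) → ℕ → ℕ → ℕ → ℕ
orbit-test f x x′ n = ifz (distinct (iter f n x) x′) 0 (distinct (iter f n x′) x)

orbit-test-complete : ∀ f x x′ n → (iter f n x ≡ x′) ⊎ (iter f n x′ ≡ x) → orbit-test f x x′ n ≡ 0
orbit-test-complete f x x′ n (inj₁ refl) rewrite distinct-refl (iter f n x) = refl
orbit-test-complete f x x′ n (inj₂ refl) = ifz-zero (distinct (iter f n x) x′) (distinct-refl (iter f n x′))
  where
  ifz-zero : ∀ c {b} → b ≡ 0 → ifz c 0 b ≡ 0
  ifz-zero zero    _   = refl
  ifz-zero (suc _) b≡0 = b≡0

orbit-test-sound : ∀ f x x′ n → orbit-test f x x′ n ≡ 0 → (iter f n x ≡ x′) ⊎ (iter f n x′ ≡ x)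
orbit-test-sound f x x′ n test≡0 with distinct (iter f n x) x′ in eq
... | zero  = inj₁ (distinct≡0⇒≡ _ _ eq)
... | suc _ = inj₂ (distinct≡0⇒≡ _ _ test≡0)

Cyc-≤₁-K : ∀ f → Recursive f → Cyc f ≤₁ K
Cyc-≤₁-K f (e , e-computes) = Σ₁-≤₁-K ⟦ OrbitTest ⟧ (code-computes OrbitTest) Cyc⇔
  where
  ItF X X′ N : Term
  ItF = Iterate (Ext e f e-computes)
  X   = P₁ ∙ P₁
  X′  = P₂ ∙ P₁
  N   = P₂

  OrbitTest : Term
  OrbitTest = Ifz (Distinct (ItF ∙ Pair X N) X′) Z (Distinct (ItF ∙ Pair X′ N) X)

  ⟦OrbitTest⟧ : ∀ x x′ n → ⟦ OrbitTest ⟧ ⟨ ⟨ x , x′ ⟩ , n ⟩ ≡ orbit-test f x x′ n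
  ⟦OrbitTest⟧ x x′ n = trans (sym (flatten-⟦⟧ᵀ OrbitTest τ)) on-trees
    where
    τ : Tree
    τ = node (node (leaf x) (leaf x′)) (leaf n)
    on-trees : flatten (⟦ OrbitTest ⟧ᵀ τ) ≡ orbit-test f x x′ n
    on-trees
      rewrite Ifz-ᵀ (Distinct (ItF ∙ Pair X N) X′) Z (Distinct (ItF ∙ Pair X′ N) X) τ
            | Distinct-ᵀ (ItF ∙ Pair X N) X′ τ | Distinct-ᵀ (ItF ∙ Pair X′ N) X τ
            | Iterate-ᵀ (Ext e f e-computes) (leaf x) (leaf n) | Iterate-ᵀ (Ext e f e-computes) (leaf x′) (leaf n) = refl

  Cyc⇔ : ∀ z → Cyc f z ⇔ ∃ λ n → ⟦ OrbitTest ⟧ ⟨ z , n ⟩ ≡ 0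
  Cyc⇔ z = mk⇔ to from
    where
    to : Cyc f z → ∃ λ n → ⟦ OrbitTest ⟧ ⟨ z , n ⟩ ≡ 0
    to (x , x′ , refl , n , orbit) = n , trans (⟦OrbitTest⟧ x x′ n) (orbit-test-complete f x x′ n orbit)
    from : (∃ λ n → ⟦ OrbitTest ⟧ ⟨ z , n ⟩ ≡ 0) → Cyc f z
    from (n , test≡0) = π₁ z , π₂ z , sym (pair-π z) , n , orbit-test-sound f (π₁ z) (π₂ z) n
      (trans (sym (⟦OrbitTest⟧ (π₁ z) (π₂ z) n))
             (subst (λ w → ⟦ OrbitTest ⟧ ⟨ w , n ⟩ ≡ 0) (sym (pair-π z)) test≡0))

-- A small-step machine for eval

-- A rec-frame k g y j m waits for the value at j with m recursion steps left; a
-- μ-frame k a x i b waits for a ⟨ x , i ⟩ with b further candidates allowed.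
data Frame : Set where
  ∘-frame     : (k f : ℕ) → Frame
  pair₁-frame : (k g x : ℕ) → Frame
  pair₂-frame : (u : ℕ) → Frame
  rec-frame   : (k g y j m : ℕ) → Frame
  μ-frame     : (k a x i b : ℕ) → Frame

data State : Set where
  call   : (k e x : ℕ) → List Frame → State
  return : Maybe ℕ → List Frame → State

dispatch : ℕ → ℕ × ℕ → ℕ → List Frame → State
dispatch k (0 , _) x s = return (just 0) s
dispatch k (1 , _) x s = return (just (suc x)) s
dispatch k (2 , _) x s = return (just (π₁ x)) s
dispatch k (3 , _) x s = return (just (π₂ x)) s
dispatch k (4 , a) x s = call k (π₂ a) x (∘-frame k (π₁ a) ∷ s)
dispatch k (5 , a) x s = call k (π₁ a) x (pair₁-frame k (π₂ a) x ∷ s)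
dispatch k (6 , a) x s = call k (π₁ a) (π₁ x) (rec-frame k (π₂ a) (π₁ x) 0 (π₂ x) ∷ s)
dispatch zero    (suc (suc (suc (suc (suc (suc (suc _)))))) , a) x s = return nothing s
dispatch (suc k) (suc (suc (suc (suc (suc (suc (suc _)))))) , a) x s = call (suc k) a ⟨ x , 0 ⟩ (μ-frame (suc k) a x 0 k ∷ s)

step : State → State
step (call zero e x s)                                = return nothing s
step (call (suc k) e x s)                             = dispatch k (unpair e) x s
step (return v [])                                    = return v []
step (return nothing (_ ∷ s))                         = return nothing s
step (return (just u) (∘-frame k f ∷ s))              = call k f u s
step (return (just u) (pair₁-frame k g x ∷ s))        = call k g x (pair₂-frame u ∷ s)
step (return (just v) (pair₂-frame u ∷ s))            = return (just ⟨ u , v ⟩) s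
step (return (just r) (rec-frame k g y j zero ∷ s))    = return (just r) s
step (return (just r) (rec-frame k g y j (suc m) ∷ s)) = call k g ⟨ y , ⟨ j , r ⟩ ⟩ (rec-frame k g y (suc j) m ∷ s)
step (return (just zero) (μ-frame k a x i b ∷ s))          = return (just i) s
step (return (just (suc _)) (μ-frame k a x i zero ∷ s))    = return nothing s
step (return (just (suc _)) (μ-frame k a x i (suc b) ∷ s)) = call k a ⟨ x , suc i ⟩ (μ-frame k a x (suc i) b ∷ s)

run : ℕ → State → State
run zero    s = s
run (suc n) s = step (run n s)

run-+ : ∀ m n s → run (m + n) s ≡ run m (run n s)
run-+ zero    n s = refl
run-+ (suc m) n s = cong step (run-+ m n s)

infix 4 _↠_

_↠_ : State → State → Set
s ↠ s′ = ∃ λ n → run n s ≡ s′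

↠-refl : ∀ {s} → s ↠ s
↠-refl = 0 , refl

↠-trans : ∀ {s₁ s₂ s₃} → s₁ ↠ s₂ → s₂ ↠ s₃ → s₁ ↠ s₃
↠-trans {s₁} (m , p) (n , q) = n + m , trans (run-+ n m s₁) (trans (cong (run n) p) q)

↠-step : ∀ {s s′} → step s ↠ s′ → s ↠ s′
↠-step {s} (n , q) = n + 1 , trans (run-+ n 1 s) q

Simulates : ℕ → Set
Simulates k = ∀ e x s → call k e x s ↠ return (eval k e x) s

∘-return : ∀ k f g x s → Simulates k →
           return (eval k g x) (∘-frame k f ∷ s) ↠ return (eval k g x >>= eval k f) s
∘-return k f g x s sim with eval k g x
... | nothing = ↠-step ↠-refl
... | just u  = ↠-step (sim f u s)

pair-return : ∀ k f g x s → Simulates k →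
              return (eval k f x) (pair₁-frame k g x ∷ s) ↠
              return (eval k f x >>= λ u → eval k g x >>= λ v → just ⟨ u , v ⟩) s
pair-return k f g x s sim with eval k f x
... | nothing = ↠-step ↠-refl
... | just u  = ↠-step (↠-trans (sim g x _) second)
  where
  second : return (eval k g x) (pair₂-frame u ∷ s) ↠ return (eval k g x >>= λ v → just ⟨ u , v ⟩) s
  second with eval k g x
  ... | nothing = ↠-step ↠-refl
  ... | just v  = ↠-step ↠-refl

primRec-nothing : ∀ {b g : ℕ → Maybe ℕ} y j m → primRec b g y j ≡ nothing → primRec b g y (j + m) ≡ nothing
primRec-nothing y j zero    eq rewrite +-identityʳ j = eq
primRec-nothing {b} {g} y j (suc m) eq rewrite +-suc j m | primRec-nothing {b} {g} y j m eq = refl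

rec-loop : ∀ k → Simulates k → ∀ (b : ℕ → Maybe ℕ) g y m j s →
           return (primRec b (eval k g) y j) (rec-frame k g y j m ∷ s) ↠ return (primRec b (eval k g) y (j + m)) s
rec-loop k sim b g y m j s with primRec b (eval k g) y j in eq
... | nothing = ↠-step (0 , cong (λ v → return v s) (sym (primRec-nothing {b} {eval k g} y j m eq)))
rec-loop k sim b g y zero j s | just r rewrite +-identityʳ j | eq = ↠-step ↠-refl
rec-loop k sim b g y (suc m) j s | just r =
  ↠-step (↠-trans (sim g ⟨ y , ⟨ j , r ⟩ ⟩ _)
                  (subst₂ (λ v w → return v (rec-frame k g y (suc j) m ∷ s) ↠ return (primRec b (eval k g) y w) s)
                          next (sym (+-suc j m)) (rec-loop k sim b g y m (suc j) s)))
  where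
  next : primRec b (eval k g) y (suc j) ≡ eval k g ⟨ y , ⟨ j , r ⟩ ⟩
  next rewrite eq = refl

μ-loop : ∀ k → Simulates k → ∀ a x b i s →
         return (eval k a ⟨ x , i ⟩) (μ-frame k a x i b ∷ s) ↠ return (muSearch (suc b) (eval k a) x i) s
μ-loop k sim a x b i s with eval k a ⟨ x , i ⟩
... | nothing = ↠-step ↠-refl
... | just zero = ↠-step ↠-refl
μ-loop k sim a x zero    i s | just (suc _) = ↠-step ↠-refl
μ-loop k sim a x (suc b) i s | just (suc _) = ↠-step (↠-trans (sim a _ _) (μ-loop k sim a x b (suc i) s))

call-↠ : ∀ k → Simulates k
dispatch-↠ : ∀ k e x s → dispatch k (unpair e) x s ↠ return (eval (suc k) e x) s

call-↠ zero    e x s = ↠-step ↠-refl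
call-↠ (suc k) e x s = ↠-step (dispatch-↠ k e x s)

dispatch-↠ k e x s with unpair e
... | 0 , a = ↠-refl
... | 1 , a = ↠-refl
... | 2 , a = ↠-refl
... | 3 , a = ↠-refl
... | 4 , a = ↠-trans (call-↠ k (π₂ a) x _) (∘-return k (π₁ a) (π₂ a) x s (call-↠ k))
... | 5 , a = ↠-trans (call-↠ k (π₁ a) x _) (pair-return k (π₁ a) (π₂ a) x s (call-↠ k))
... | 6 , a = ↠-trans (call-↠ k (π₁ a) (π₁ x) _) (rec-loop k (call-↠ k) (eval k (π₁ a)) (π₂ a) (π₁ x) (π₂ x) 0 s)
dispatch-↠ zero    e x s | suc (suc (suc (suc (suc (suc (suc _)))))) , a = ↠-refl
dispatch-↠ (suc k) e x s | suc (suc (suc (suc (suc (suc (suc _)))))) , a =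
  ↠-trans (call-↠ (suc k) a ⟨ x , 0 ⟩ _) (μ-loop (suc k) (call-↠ (suc k)) a x k 0 s)

encode-result : Maybe ℕ → ℕ
encode-result nothing  = 0
encode-result (just y) = suc y

frameᵀ : Frame → Tree
frameᵀ (∘-frame k f)         = node (leaf 0) (node (leaf k) (leaf f))
frameᵀ (pair₁-frame k g x)   = node (leaf 1) (node (leaf k) (node (leaf g) (leaf x)))
frameᵀ (pair₂-frame u)       = node (leaf 2) (leaf u)
frameᵀ (rec-frame k g y j m) = node (leaf 3) (node (leaf k) (node (leaf g) (node (leaf y) (node (leaf j) (leaf m)))))
frameᵀ (μ-frame k a x i b)   = node (leaf 4) (node (leaf k) (node (leaf a) (node (leaf x) (node (leaf i) (leaf b)))))

stackᵀ : List Frame → Tree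
stackᵀ []      = leaf 0
stackᵀ (f ∷ s) = node (leaf 1) (node (frameᵀ f) (stackᵀ s))

stateᵀ : State → Tree
stateᵀ (call k e x s) = node (leaf 0) (node (leaf k) (node (leaf e) (node (leaf x) (stackᵀ s))))
stateᵀ (return v s)   = node (leaf 1) (node (leaf (encode-result v)) (stackᵀ s))

encode : State → ℕ
encode st = flatten (stateᵀ st)

Switch : List Term → Term → Term → Term
Switch []       default c = default
Switch (a ∷ as) default c = Ifz c a (Switch as default (Pred ∙ c))

Return : Term → Term → Term
Return v s = Pair (Const 1) (Pair v s)

Call : Term → Term → Term → Term → Term
Call k e x s = Pair (Const 0) (Pair k (Pair e (Pair x s)))

Push : Term → Term → Term
Push frame s = Pair (Const 1) (Pair frame s)

-- Acts on the payload  node (leaf k) (node (leaf e) (node (leaf x) stack))  of a call state.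
module CallStep where
  Fuel Code Arg Stack Fuel′ Tag Args : Term
  Fuel  = P₁
  Code  = P₁ ∙ P₂
  Arg   = P₁ ∙ P₂ ∙ P₂
  Stack = P₂ ∙ P₂ ∙ P₂
  Fuel′ = Pred ∙ Fuel
  Tag   = P₁ ∙ Code
  Args  = P₂ ∙ Code

  on-zero on-succ on-π₁ on-π₂ on-∘ on-pair on-rec on-μ : Term
  on-zero = Return (Const 1) Stack
  on-succ = Return (S ∙ S ∙ Arg) Stack
  on-π₁   = Return (S ∙ P₁ ∙ Arg) Stack
  on-π₂   = Return (S ∙ P₂ ∙ Arg) Stack
  on-∘    = Call Fuel′ (P₂ ∙ Args) Arg (Push (Pair (Const 0) (Pair Fuel′ (P₁ ∙ Args))) Stack)
  on-pair = Call Fuel′ (P₁ ∙ Args) Arg (Push (Pair (Const 1) (Pair Fuel′ (Pair (P₂ ∙ Args) Arg))) Stack)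
  on-rec  = Call Fuel′ (P₁ ∙ Args) (P₁ ∙ Arg)
                 (Push (Pair (Const 3) (Pair Fuel′ (Pair (P₂ ∙ Args) (Pair (P₁ ∙ Arg) (Pair (Const 0) (P₂ ∙ Arg)))))) Stack)
  on-μ    = Ifz Fuel′ (Return (Const 0) Stack)
                (Call Fuel′ Args (Pair Arg (Const 0))
                      (Push (Pair (Const 4) (Pair Fuel′ (Pair Args (Pair Arg (Pair (Const 0) (Pred ∙ Fuel′)))))) Stack))

  CallStep : Term
  CallStep = Ifz Fuel (Return (Const 0) Stack)
                 (Switch (on-zero ∷ on-succ ∷ on-π₁ ∷ on-π₂ ∷ on-∘ ∷ on-pair ∷ on-rec ∷ []) on-μ Tag)

-- Acts on the payload  node (leaf v) stack  of a return state.
module ReturnStep where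
  Value Stack Top Rest TopTag Fields Result : Term
  Value  = P₁
  Stack  = P₂
  Top    = P₁ ∙ P₂ ∙ Stack
  Rest   = P₂ ∙ P₂ ∙ Stack
  TopTag = P₁ ∙ Top
  Fields = P₂ ∙ Top
  Result = Pred ∙ Value

  field₁ field₂ field₃ field₄ field₅ : Term
  field₁ = P₁ ∙ Fields
  field₂ = P₁ ∙ P₂ ∙ Fields
  field₃ = P₁ ∙ P₂ ∙ P₂ ∙ Fields
  field₄ = P₁ ∙ P₂ ∙ P₂ ∙ P₂ ∙ Fields
  field₅ = P₂ ∙ P₂ ∙ P₂ ∙ P₂ ∙ Fields

  on-∘ on-pair₁ on-pair₂ on-rec on-μ : Term
  on-∘     = Call field₁ (P₂ ∙ Fields) Result Rest
  on-pair₁ = Call field₁ field₂ (P₂ ∙ P₂ ∙ Fields) (Push (Pair (Const 2) Result) Rest)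
  on-pair₂ = Return (S ∙ Pair Fields Result) Rest
  on-rec   = Ifz field₅ (Return Value Rest)
                 (Call field₁ field₂ (Pair field₃ (Pair field₄ Result))
                       (Push (Pair (Const 3) (Pair field₁ (Pair field₂ (Pair field₃ (Pair (S ∙ field₄) (Pred ∙ field₅)))))) Rest))
  on-μ     = Ifz Result (Return (S ∙ field₄) Rest)
                 (Ifz field₅ (Return (Const 0) Rest)
                      (Call field₁ field₂ (Pair field₃ (S ∙ field₄))
                            (Push (Pair (Const 4) (Pair field₁ (Pair field₂ (Pair field₃ (Pair (S ∙ field₄) (Pred ∙ field₅)))))) Rest)))

  ReturnStep : Term
  ReturnStep = Ifz (P₁ ∙ Stack) (Return Value Stack)
                   (Ifz Value (Return (Const 0) Rest) (Switch (on-∘ ∷ on-pair₁ ∷ on-pair₂ ∷ on-rec ∷ []) on-μ TopTag))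

open CallStep using (CallStep)
open ReturnStep using (ReturnStep)

Step : Term
Step = Ifz P₁ (CallStep ∙ P₂) (ReturnStep ∙ P₂)

Step-ᵀ : ∀ st → flatten (⟦ Step ⟧ᵀ (stateᵀ st)) ≡ encode (step st)
Step-ᵀ (call zero e x s) = refl
Step-ᵀ (call (suc k) e x s) with unpair e
... | 0 , _ = refl
... | 1 , _ = refl
... | 2 , _ = refl
... | 3 , _ = refl
... | 4 , _ = refl
... | 5 , _ = refl
... | 6 , _ = refl
Step-ᵀ (call (suc zero)    e x s) | suc (suc (suc (suc (suc (suc (suc _)))))) , _ = refl
Step-ᵀ (call (suc (suc k)) e x s) | suc (suc (suc (suc (suc (suc (suc _)))))) , _ = refl
Step-ᵀ (return v [])                                    = refl
Step-ᵀ (return nothing (_ ∷ s))                         = refl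
Step-ᵀ (return (just u) (∘-frame k f ∷ s))              = refl
Step-ᵀ (return (just u) (pair₁-frame k g x ∷ s))        = refl
Step-ᵀ (return (just v) (pair₂-frame u ∷ s))            = refl
Step-ᵀ (return (just r) (rec-frame k g y j zero ∷ s))    = refl
Step-ᵀ (return (just r) (rec-frame k g y j (suc m) ∷ s)) = refl
Step-ᵀ (return (just zero) (μ-frame k a x i b ∷ s))          = refl
Step-ᵀ (return (just (suc _)) (μ-frame k a x i zero ∷ s))    = refl
Step-ᵀ (return (just (suc _)) (μ-frame k a x i (suc b) ∷ s)) = refl

⟦Step⟧ : ∀ st → ⟦ Step ⟧ (encode st) ≡ encode (step st)
⟦Step⟧ st = trans (sym (flatten-⟦⟧ᵀ Step (stateᵀ st))) (Step-ᵀ st)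

iter-⟦Step⟧ : ∀ n st → iter ⟦ Step ⟧ n (encode st) ≡ encode (run n st)
iter-⟦Step⟧ zero    st = refl
iter-⟦Step⟧ (suc n) st = trans (cong ⟦ Step ⟧ (iter-⟦Step⟧ n st)) (⟦Step⟧ (run n st))

initial : ℕ → State
initial z = call (π₁ z) (π₁ (π₂ z)) (π₂ (π₂ z)) []

Initial : Term
Initial = Pair (Const 0) (Pair P₁ (Pair (P₁ ∙ P₂) (Pair (P₂ ∙ P₂) (Const 0))))

After : Term → Term
After t = t ∙ Iterate Step ∙ Pair (Initial ∙ P₁) P₂

⟦After⟧ : ∀ t (h : State → ℕ) → (∀ st → flatten (⟦ t ⟧ᵀ (stateᵀ st)) ≡ h st) →
          ∀ z n → ⟦ After t ⟧ ⟨ z , n ⟩ ≡ h (run n (initial z))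
⟦After⟧ t h t≡h z n = begin
  ⟦ After t ⟧ ⟨ z , n ⟩                                     ≡⟨ sym (flatten-⟦⟧ᵀ (After t) (node (leaf z) (leaf n))) ⟩
  flatten (⟦ t ⟧ᵀ (⟦ Iterate Step ⟧ᵀ (node initialᵀ (leaf n)))) ≡⟨ flatten-⟦⟧ᵀ t _ ⟩
  ⟦ t ⟧ (flatten (⟦ Iterate Step ⟧ᵀ (node initialᵀ (leaf n))))  ≡⟨ cong ⟦ t ⟧ (Iterate-ᵀ Step initialᵀ (leaf n)) ⟩
  ⟦ t ⟧ (iter ⟦ Step ⟧ n (encode (initial z)))                ≡⟨ cong ⟦ t ⟧ (iter-⟦Step⟧ n (initial z)) ⟩
  ⟦ t ⟧ (encode (run n (initial z)))                          ≡⟨ sym (flatten-⟦⟧ᵀ t (stateᵀ (run n (initial z)))) ⟩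
  flatten (⟦ t ⟧ᵀ (stateᵀ (run n (initial z))))               ≡⟨ t≡h (run n (initial z)) ⟩
  h (run n (initial z))                                       ∎
  where
  initialᵀ : Tree
  initialᵀ = stateᵀ (initial z)

unfinished : State → ℕ
unfinished (call _ _ _ _)     = 1
unfinished (return v [])      = 0
unfinished (return v (_ ∷ _)) = 1

Unfinished : Term
Unfinished = Ifz P₁ (Const 1) (Ifz (P₁ ∙ P₂ ∙ P₂) Z (Const 1))

Unfinished-ᵀ : ∀ st → flatten (⟦ Unfinished ⟧ᵀ (stateᵀ st)) ≡ unfinished st
Unfinished-ᵀ (call _ _ _ _)     = refl
Unfinished-ᵀ (return v [])      = refl
Unfinished-ᵀ (return v (_ ∷ _)) = refl

unfinished≡0⇒final : ∀ st → unfinished st ≡ 0 → ∃ λ v → st ≡ return v []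
unfinished≡0⇒final (return v []) _ = v , refl

-- Only the value of a final state is meaningful.
output : State → ℕ
output (call k _ _ _) = k
output (return v _)   = encode-result v

Output : Term
Output = P₁ ∙ P₂

Output-ᵀ : ∀ st → flatten (⟦ Output ⟧ᵀ (stateᵀ st)) ≡ output st
Output-ᵀ (call _ _ _ _) = refl
Output-ᵀ (return v s)   = refl

run-final : ∀ n v → run n (return v []) ≡ return v []
run-final zero    v = refl
run-final (suc n) v rewrite run-final n v = refl

run-final-≤ : ∀ {m n s v} → m ≤ n → run m s ≡ return v [] → run n s ≡ return v []
run-final-≤ {m} {n} {s} {v} m≤n run-m = begin
  run n s                   ≡⟨ cong (λ k → run k s) (m∸n+n≡m m≤n) ⟨
  run (n ∸ m + m) s         ≡⟨ run-+ (n ∸ m) m s ⟩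
  run (n ∸ m) (run m s)     ≡⟨ cong (run (n ∸ m)) run-m ⟩
  run (n ∸ m) (return v []) ≡⟨ run-final (n ∸ m) v ⟩
  return v []               ∎

return-injective : ∀ {v w s} → return v s ≡ return w s → v ≡ w
return-injective refl = refl

final-unique : ∀ {m n s v w} → run m s ≡ return v [] → run n s ≡ return w [] → v ≡ w
final-unique {m} {n} run-m run-n with ≤-total m n
... | inj₁ m≤n = return-injective (trans (sym (run-final-≤ m≤n run-m)) run-n)
... | inj₂ n≤m = sym (return-injective (trans (sym (run-final-≤ n≤m run-n)) run-m))

search-then : ℕ → ℕ → ℕ
search-then o t = ∘-code o (pair-code id-code (μ-code t))

⇓-search-then : ∀ {o t} {Out Test : ℕ → ℕ} → Computes o Out → Computes t Test → ∀ {z m} →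
                Test ⟨ z , m ⟩ ≡ 0 → (∀ j → j < m → ¬ Test ⟨ z , j ⟩ ≡ 0) →
                search-then o t · z ⇓ Out ⟨ z , m ⟩
⇓-search-then {Test = Test} o⇓ t⇓ {z} {m} stop below =
  ⇓-∘ (⇓-pair (⇓-id z) (⇓-μ (λ n → Test ⟨ z , n ⟩) (λ n → t⇓ ⟨ z , n ⟩) stop below)) (o⇓ ⟨ z , m ⟩)

bounded-eval : ℕ → ℕ
bounded-eval z = encode-result (eval (π₁ z) (π₁ (π₂ z)) (π₂ (π₂ z)))

-- The codes are kept abstract: normalising the numeral code of a concrete term is infeasible.
bounded-eval-computes : ∀ {o t} → Computes o ⟦ After Output ⟧ → Computes t ⟦ After Unfinished ⟧ →
                        Computes (search-then o t) bounded-eval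
bounded-eval-computes {o} {t} o⇓ t⇓ z = first-stop (call-↠ (π₁ z) (π₁ (π₂ z)) (π₂ (π₂ z)) [])
  where
  unfinished-after : ℕ → ℕ
  unfinished-after n = ⟦ After Unfinished ⟧ ⟨ z , n ⟩

  finished-at : ∀ n {v} → run n (initial z) ≡ return v [] → unfinished-after n ≡ 0
  finished-at n run-n = trans (⟦After⟧ Unfinished unfinished Unfinished-ᵀ z n) (cong unfinished run-n)

  output-at : ∀ m {v} → run m (initial z) ≡ return v [] → ⟦ After Output ⟧ ⟨ z , m ⟩ ≡ encode-result v
  output-at m run-m = trans (⟦After⟧ Output output Output-ᵀ z m) (cong output run-m)

  halt-at : ∀ {N v} → run N (initial z) ≡ return v [] →
            (∃ λ m → unfinished-after m ≡ 0 × (∀ j → j < m → ¬ unfinished-after j ≡ 0)) →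
            search-then o t · z ⇓ encode-result v
  halt-at {N} run-N (m , stopped , below) =
    let _ , run-m = unfinished≡0⇒final (run m (initial z))
                      (trans (sym (⟦After⟧ Unfinished unfinished Unfinished-ᵀ z m)) stopped)
    in subst (search-then o t · z ⇓_) (trans (output-at m run-m) (cong encode-result (final-unique {m} {N} run-m run-N)))
             (⇓-search-then o⇓ t⇓ {z} {m} stopped below)

  first-stop : initial z ↠ return (eval (π₁ z) (π₁ (π₂ z)) (π₂ (π₂ z))) [] →
               search-then o t · z ⇓ bounded-eval z
  first-stop (N , run-N) = halt-at {N} run-N (least-witness (λ n → unfinished-after n ≟ 0) (finished-at N run-N))

bounded-eval-recursive : Recursive bounded-eval
bounded-eval-recursive = _ , bounded-eval-computes (code-computes (After Output)) (code-computes (After Unfinished))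

-- A recursive permutation whose orbits detect halting

iter-suc : ∀ (f : ℕ → ℕ) n z → iter f (suc n) z ≡ iter f n (f z)
iter-suc f zero    z = refl
iter-suc f (suc n) z = cong f (iter-suc f n z)

iter-+ : ∀ (f : ℕ → ℕ) m n z → iter f (m + n) z ≡ iter f m (iter f n z)
iter-+ f zero    n z = refl
iter-+ f (suc m) n z = cong f (iter-+ f m n z)

lanewise : (ℕ → ℕ → ℕ → ℕ × ℕ) → ℕ → ℕ
lanewise g z = ⟨ π₁ z , uncurry ⟨_,_⟩ (g (π₁ z) (π₁ (π₂ z)) (π₂ (π₂ z))) ⟩

lanewise-point : ∀ g x c i → lanewise g ⟨ x , ⟨ c , i ⟩ ⟩ ≡ ⟨ x , uncurry ⟨_,_⟩ (g x c i) ⟩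
lanewise-point g x c i rewrite π₁-pair x ⟨ c , i ⟩ | π₂-pair x ⟨ c , i ⟩ | π₁-pair c i | π₂-pair c i = refl

lanewise-inverse : ∀ g h → (∀ x c i → uncurry (g x) (h x c i) ≡ (c , i)) → ∀ z → lanewise g (lanewise h z) ≡ z
lanewise-inverse g h g∘h z = begin
  lanewise g (lanewise h z)                       ≡⟨ lanewise-point g x (proj₁ (h x c i)) (proj₂ (h x c i)) ⟩
  ⟨ x , uncurry ⟨_,_⟩ (uncurry (g x) (h x c i)) ⟩ ≡⟨ cong (λ p → ⟨ x , uncurry ⟨_,_⟩ p ⟩) (g∘h x c i) ⟩
  ⟨ x , ⟨ c , i ⟩ ⟩                               ≡⟨ pair-π-π₂ z ⟩
  z                                               ∎
  where
  x c i : ℕ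
  x = π₁ z
  c = π₁ (π₂ z)
  i = π₂ (π₂ z)

-- D ⟨ x , i ⟩ ≢ 0 signals that x has halted by stage i.
module Ladder {d} (D : ℕ → ℕ) (d-computes : Computes d D) where

  point : ℕ → ℕ → ℕ → ℕ
  point x c i = ⟨ x , ⟨ c , i ⟩ ⟩

  next prev : ℕ → ℕ → ℕ → ℕ × ℕ
  next x 0 i       = ifz (D ⟨ x , i ⟩) (0 , suc i) (3 , i)
  next x 1 0       = 0 , 0
  next x 1 (suc i) = 1 , i
  next x 2 i       = 2 , suc i
  next x 3 0       = 2 , 0
  next x 3 (suc i) = ifz (D ⟨ x , i ⟩) (3 , i) (0 , suc i)
  next x c@(suc (suc (suc (suc _)))) i = c , i
  prev x 0 0       = 1 , 0
  prev x 0 (suc i) = ifz (D ⟨ x , i ⟩) (0 , i) (3 , suc i)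
  prev x 1 i       = 1 , suc i
  prev x 2 0       = 3 , 0
  prev x 2 (suc i) = 2 , i
  prev x 3 i       = ifz (D ⟨ x , i ⟩) (3 , suc i) (0 , i)
  prev x c@(suc (suc (suc (suc _)))) i = c , i

  next-prev : ∀ x c i → uncurry (next x) (prev x c i) ≡ (c , i)
  next-prev x 0 0       = refl
  next-prev x 0 (suc i) with D ⟨ x , i ⟩ in eq
  ... | zero  = ifz-cong eq
  ... | suc _ = ifz-cong eq
  next-prev x 1 i       = refl
  next-prev x 2 0       = refl
  next-prev x 2 (suc i) = refl
  next-prev x 3 i with D ⟨ x , i ⟩ in eq
  ... | zero  = ifz-cong eq
  ... | suc _ = ifz-cong eq
  next-prev x (suc (suc (suc (suc _)))) i = refl

  prev-next : ∀ x c i → uncurry (prev x) (next x c i) ≡ (c , i)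
  prev-next x 0 i with D ⟨ x , i ⟩ in eq
  ... | zero  = ifz-cong eq
  ... | suc _ = ifz-cong eq
  prev-next x 1 0       = refl
  prev-next x 1 (suc i) = refl
  prev-next x 2 i       = refl
  prev-next x 3 0       = refl
  prev-next x 3 (suc i) with D ⟨ x , i ⟩ in eq
  ... | zero  = ifz-cong eq
  ... | suc _ = ifz-cong eq
  prev-next x (suc (suc (suc (suc _)))) i = refl

  σ : ℕ → ℕ
  σ = lanewise next

  σ-bijective : Bijective _≡_ _≡_ σ
  σ-bijective = Bijection.bijective (↔⇒⤖ (mk↔ₛ′ σ (lanewise prev)
    (lanewise-inverse next prev next-prev) (lanewise-inverse prev next prev-next)))

  Next : Term
  Next = Switch (on-0 ∷ on-1 ∷ on-2 ∷ on-3 ∷ []) Id Lane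
    where
    X Lane Index Halted Halted′ : Term
    X        = P₁
    Lane     = P₁ ∙ P₂
    Index    = P₂ ∙ P₂
    Halted  = Ext d D d-computes ∙ Pair X Index
    Halted′ = Ext d D d-computes ∙ Pair X (Pred ∙ Index)
    At : Term → Term → Term
    At c i = Pair X (Pair c i)
    on-0 on-1 on-2 on-3 : Term
    on-0 = Ifz Halted (At (Const 0) (S ∙ Index)) (At (Const 3) Index)
    on-1 = Ifz Index (At (Const 0) (Const 0)) (At (Const 1) (Pred ∙ Index))
    on-2 = At (Const 2) (S ∙ Index)
    on-3 = Ifz Index (At (Const 2) (Const 0)) (Ifz Halted′ (At (Const 3) (Pred ∙ Index)) (At (Const 0) Index))

  Next-ᵀ : ∀ x c i →
           flatten (⟦ Next ⟧ᵀ (node (leaf x) (node (leaf c) (leaf i)))) ≡ ⟨ x , uncurry ⟨_,_⟩ (next x c i) ⟩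
  Next-ᵀ x 0 i with D ⟨ x , i ⟩
  ... | zero  = refl
  ... | suc _ = refl
  Next-ᵀ x 1 zero    = refl
  Next-ᵀ x 1 (suc i) = refl
  Next-ᵀ x 2 i       = refl
  Next-ᵀ x 3 zero    = refl
  Next-ᵀ x 3 (suc i) with D ⟨ x , i ⟩
  ... | zero  = refl
  ... | suc _ = refl
  Next-ᵀ x (suc (suc (suc (suc _)))) i = refl

  σ-computes : Computes (code Next) σ
  σ-computes z = subst (code Next · z ⇓_) ⟦Next⟧≡σ (code-computes Next z)
    where
    x c i : ℕ
    x = π₁ z
    c = π₁ (π₂ z)
    i = π₂ (π₂ z)
    ⟦Next⟧≡σ : ⟦ Next ⟧ z ≡ σ z
    ⟦Next⟧≡σ = begin
      ⟦ Next ⟧ z                                                ≡⟨ cong ⟦ Next ⟧ (pair-π-π₂ z) ⟨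
      ⟦ Next ⟧ ⟨ x , ⟨ c , i ⟩ ⟩                                ≡⟨ flatten-⟦⟧ᵀ Next (node (leaf x) (node (leaf c) (leaf i))) ⟨
      flatten (⟦ Next ⟧ᵀ (node (leaf x) (node (leaf c) (leaf i)))) ≡⟨ Next-ᵀ x c i ⟩
      σ z                                                       ∎

  σ-recursive-permutation : RecPerm σ
  σ-recursive-permutation = (code Next , σ-computes) , σ-bijective

  σ-point : ∀ x c i → σ (point x c i) ≡ ⟨ x , uncurry ⟨_,_⟩ (next x c i) ⟩
  σ-point = lanewise-point next

  climb : ∀ x i → D ⟨ x , i ⟩ ≡ 0 → σ (point x 0 i) ≡ point x 0 (suc i)
  climb x i unfinished = trans (σ-point x 0 i) (cong (λ p → ⟨ x , uncurry ⟨_,_⟩ p ⟩) (ifz-cong unfinished))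

  descend : ∀ x i → D ⟨ x , i ⟩ ≡ 0 → σ (point x 3 (suc i)) ≡ point x 3 i
  descend x i unfinished = trans (σ-point x 3 (suc i)) (cong (λ p → ⟨ x , uncurry ⟨_,_⟩ p ⟩) (ifz-cong unfinished))

  turn : ∀ x i → D ⟨ x , i ⟩ ≢ 0 → σ (point x 0 i) ≡ point x 3 i
  turn x i stopped with D ⟨ x , i ⟩ in eq
  ... | zero  = ⊥-elim (stopped refl)
  ... | suc _ = trans (σ-point x 0 i) (cong (λ p → ⟨ x , uncurry ⟨_,_⟩ p ⟩) (ifz-cong eq))

  climb-to : ∀ x {s} → (∀ j → j < s → D ⟨ x , j ⟩ ≡ 0) →
             ∀ j → j ≤ s → iter σ j (point x 0 0) ≡ point x 0 j
  climb-to x below zero    _   = refl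
  climb-to x below (suc j) j<s = trans (cong σ (climb-to x below j (<⇒≤ j<s))) (climb x j (below j j<s))

  descend-from : ∀ x {s} → (∀ j → j < s → D ⟨ x , j ⟩ ≡ 0) →
                 ∀ j → j ≤ s → iter σ (suc j) (point x 3 j) ≡ point x 2 0
  descend-from x below zero    _   = σ-point x 3 0
  descend-from x below (suc j) j<s = begin
    iter σ (suc (suc j)) (point x 3 (suc j)) ≡⟨ iter-suc σ (suc j) (point x 3 (suc j)) ⟩
    iter σ (suc j) (σ (point x 3 (suc j)))   ≡⟨ cong (iter σ (suc j)) (descend x j (below j j<s)) ⟩
    iter σ (suc j) (point x 3 j)             ≡⟨ descend-from x below j (<⇒≤ j<s) ⟩
    point x 2 0                              ∎

  first-stop-orbit : ∀ x {s} → D ⟨ x , s ⟩ ≢ 0 → (∀ j → j < s → D ⟨ x , j ⟩ ≡ 0) →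
                     iter σ (suc s + suc s) (point x 0 0) ≡ point x 2 0
  first-stop-orbit x {s} stopped below = begin
    iter σ (suc s + suc s) (point x 0 0)          ≡⟨ iter-+ σ (suc s) (suc s) (point x 0 0) ⟩
    iter σ (suc s) (iter σ (suc s) (point x 0 0)) ≡⟨ cong (λ p → iter σ (suc s) (σ p)) (climb-to x below s ≤-refl) ⟩
    iter σ (suc s) (σ (point x 0 s))              ≡⟨ cong (iter σ (suc s)) (turn x s stopped) ⟩
    iter σ (suc s) (point x 3 s)                  ≡⟨ descend-from x below s ≤-refl ⟩
    point x 2 0                                   ∎

  climb-or-stop : ∀ x n → (∃ λ i → D ⟨ x , i ⟩ ≢ 0) ⊎ iter σ n (point x 0 0) ≡ point x 0 n
  climb-or-stop x zero = inj₂ refl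
  climb-or-stop x (suc n) with climb-or-stop x n | D ⟨ x , n ⟩ ≟ 0
  ... | inj₁ stop    | _           = inj₁ stop
  ... | inj₂ climbed | yes unfinished = inj₂ (trans (cong σ climbed) (climb x n unfinished))
  ... | inj₂ _       | no stopped  = inj₁ (n , stopped)

  lane-2 : ∀ x n → iter σ n (point x 2 0) ≡ point x 2 n
  lane-2 x zero    = refl
  lane-2 x (suc n) = trans (cong σ (lane-2 x n)) (σ-point x 2 n)

  lanes-0-2-disjoint : ∀ x n m → point x 0 n ≢ point x 2 m
  lanes-0-2-disjoint x n m eq with pair-injectiveˡ {0} {n} {2} {m} (pair-injectiveʳ {x} {_} {x} eq)
  ... | ()

  stop⇔orbit : ∀ x → (∃ λ i → D ⟨ x , i ⟩ ≢ 0) ⇔ point x 0 0 ≡[ σ ] point x 2 0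
  stop⇔orbit x = mk⇔ stop⇒orbit orbit⇒stop
    where
    stop⇒orbit : (∃ λ i → D ⟨ x , i ⟩ ≢ 0) → point x 0 0 ≡[ σ ] point x 2 0
    stop⇒orbit (_ , stopped) with least-witness (λ j → ¬? (D ⟨ x , j ⟩ ≟ 0)) stopped
    ... | s , stopped-s , below =
      suc s + suc s , inj₁ (first-stop-orbit x stopped-s (λ j j<s → decidable-stable (D ⟨ x , j ⟩ ≟ 0) (below j j<s)))
    orbit⇒stop : point x 0 0 ≡[ σ ] point x 2 0 → ∃ λ i → D ⟨ x , i ⟩ ≢ 0
    orbit⇒stop (n , inj₂ back) = ⊥-elim (lanes-0-2-disjoint x 0 n (trans (sym back) (lane-2 x n)))
    orbit⇒stop (n , inj₁ forth) with climb-or-stop x n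
    ... | inj₁ stop    = stop
    ... | inj₂ climbed = ⊥-elim (lanes-0-2-disjoint x n 0 (trans (sym climbed) forth))

  stops-≤₁-Cyc : (λ x → ∃ λ i → D ⟨ x , i ⟩ ≢ 0) ≤₁ Cyc σ
  stops-≤₁-Cyc = r , (code R , code-computes R) , r-injective , λ x → mk⇔ (to x) (from x)
    where
    r : ℕ → ℕ
    r x = ⟨ point x 0 0 , point x 2 0 ⟩
    R : Term
    R = Pair (Pair Id (Const 0)) (Pair Id (Const ⟨ 2 , 0 ⟩))
    r-injective : Injective _≡_ _≡_ r
    r-injective {a} {b} eq =
      pair-injectiveˡ {a} {_} {b} (pair-injectiveˡ {point a 0 0} {point a 2 0} {point b 0 0} {point b 2 0} eq)
    to : ∀ x → (∃ λ i → D ⟨ x , i ⟩ ≢ 0) → Cyc σ (r x)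
    to x stop = point x 0 0 , point x 2 0 , refl , Equivalence.to (stop⇔orbit x) stop
    from : ∀ x → Cyc σ (r x) → ∃ λ i → D ⟨ x , i ⟩ ≢ 0
    from x (a , b , r≡ , orbit) = Equivalence.from (stop⇔orbit x) (subst₂ (_≡[ σ ]_) a≡ b≡ orbit)
      where
      a≡ : a ≡ point x 0 0
      a≡ = sym (pair-injectiveˡ {point x 0 0} {point x 2 0} {a} {b} r≡)
      b≡ : b ≡ point x 2 0
      b≡ = sym (pair-injectiveʳ {point x 0 0} {point x 2 0} {a} {b} r≡)

≤₁-respects-⇔ : ∀ {A B C : ℕ → Set} → (∀ x → A x ⇔ B x) → B ≤₁ C → A ≤₁ C
≤₁-respects-⇔ A⇔B (r , r-recursive , r-injective , B⇔C) =
  r , r-recursive , r-injective , λ x → B⇔C x ⇔-∘ A⇔B x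

HaltsWithin : Term
HaltsWithin = Ext _ bounded-eval (proj₂ bounded-eval-recursive) ∙ Pair P₂ (Pair P₁ P₁)

⟦HaltsWithin⟧ : ∀ x i → ⟦ HaltsWithin ⟧ ⟨ x , i ⟩ ≡ encode-result (eval i x x)
⟦HaltsWithin⟧ x i
  rewrite π₁-pair x i | π₂-pair x i | π₁-pair i ⟨ x , x ⟩ | π₂-pair i ⟨ x , x ⟩ | π₁-pair x x | π₂-pair x x = refl

K⇔halts-within : ∀ x → K x ⇔ ∃ λ i → ⟦ HaltsWithin ⟧ ⟨ x , i ⟩ ≢ 0
K⇔halts-within x = mk⇔ to from
  where
  to : K x → ∃ λ i → ⟦ HaltsWithin ⟧ ⟨ x , i ⟩ ≢ 0
  to (k , y , halts) = k , λ halted≡0 →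
    0≢1+n (trans (sym halted≡0) (trans (⟦HaltsWithin⟧ x k) (cong encode-result halts)))
  from : (∃ λ i → ⟦ HaltsWithin ⟧ ⟨ x , i ⟩ ≢ 0) → K x
  from (i , halted) with eval i x x in halts
  ... | just y  = i , y , halts
  ... | nothing = ⊥-elim (halted (trans (⟦HaltsWithin⟧ x i) (cong encode-result halts)))

K-≤₁-Cyc : ∃ λ f′ → RecPerm f′ × K ≤₁ Cyc f′
K-≤₁-Cyc = σ , σ-recursive-permutation , ≤₁-respects-⇔ {C = Cyc σ} K⇔halts-within stops-≤₁-Cyc
  where open Ladder ⟦ HaltsWithin ⟧ (code-computes HaltsWithin)

proposition4p11 : (∀ f → RecPerm f → Cyc f ≤₁ K) × (∃ λ f′ → RecPerm f′ × K ≤₁ Cyc f′)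
proposition4p11 = (λ f f-perm → Cyc-≤₁-K f (proj₁ f-perm)) , K-≤₁-Cyc
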